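{- Let $n>h\geq 0$ be integers, and let $M_n^{(h)}$ be the number of edges of the Hasse diagram of the poset of independent sets of $\mathbf{C}_n^{(h)}$ ordered by inclusion. Then $M_n^{(h)}=n\,F_{n-h}^{(h)}$.
   Context: For $n,h\geq 0$, the $h$-power of a cycle $\mathbf{C}_n^{(h)}$ is the graph with vertices $v_1,\dots,v_n$ in which, for $i\neq j$, $v_i$ and $v_j$ are adjacent if and only if $|j-i|\leq h$ or $|j-i|\geq n-h$. An independent set of a graph is a subset of its vertex set containing no two adjacent vertices. The $h$-Fibonacci sequence $(F_n^{(h)})_{n\geq 1}$ is defined by $F_n^{(h)}=1$ for $1\leq n\leq h+1$ and $F_n^{(h)}=F_{n-1}^{(h)}+F_{n-h-1}^{(h)}$ for $n>h+1$. -}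

module Defs where

open import Data.Nat using (ℕ; zero; suc; _+_; _∸_; _≤ᵇ_; _≤_; _<_)
open import Data.Bool using (Bool; true; false; _∧_; _∨_; not; if_then_else_)
open import Data.Fin using (Fin; toℕ)
open import Data.Fin.Subset using (Subset; _∈_; _⊂_; inside; outside)
open import Data.Fin.Subset.Properties using (_∈?_; _⊂?_)
open import Data.List using (List; []; _∷_; map; allFin; filterᵇ; length; cartesianProduct)
open import Data.Bool.ListAction using (all; any)
open import Data.Vec using (Vec; []; _∷_)
open import Data.Product using (_×_; _,_)
open import Relation.Nullary.Decidable using (⌊_⌋)

-- h-Fibonacci sequence (indices from 1; the value at index 0 is 0 and
-- is never used):  F n = 1 for 1 ≤ n ≤ h+1,
--                  F n = F (n-1) + F (n-h-1) for n > h+1.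

nth : ℕ → List ℕ → ℕ
nth _ [] = 0
nth zero (x ∷ _) = x
nth (suc i) (_ ∷ xs) = nth i xs

-- fibs h m = [F m , F (m-1) , … , F 1 , 0]
fibs : ℕ → ℕ → List ℕ
fibs h zero = 0 ∷ []
fibs h (suc m) =
  (if suc m ≤ᵇ suc h then 1 else nth 0 (fibs h m) + nth h (fibs h m)) ∷ fibs h m

F : ℕ → ℕ → ℕ
F h n = nth 0 (fibs h n)

-- The h-power of the cycle on vertices Fin n (vertex i ↔ v_{i+1}).

absDiff : ℕ → ℕ → ℕ
absDiff a b = (a ∸ b) + (b ∸ a)

adjᵇ : (n h : ℕ) → Fin n → Fin n → Bool
adjᵇ n h i j =
  let d = absDiff (toℕ i) (toℕ j) in
  not (d ≤ᵇ 0) ∧ ((d ≤ᵇ h) ∨ ((n ∸ h) ≤ᵇ d))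

allSubsets : (n : ℕ) → List (Subset n)
allSubsets zero = [] ∷ []
allSubsets (suc n) =
  map (outside ∷_) (allSubsets n) Data.List.++ map (inside ∷_) (allSubsets n)

isIndependentᵇ : (n h : ℕ) → Subset n → Bool
isIndependentᵇ n h S =
  all (λ i → all (λ j → not (⌊ i ∈? S ⌋ ∧ ⌊ j ∈? S ⌋ ∧ adjᵇ n h i j)) (allFin n)) (allFin n)

independentSets : (n h : ℕ) → List (Subset n)
independentSets n h = filterᵇ (isIndependentᵇ n h) (allSubsets n)

coversᵇ : (n h : ℕ) → Subset n → Subset n → Bool
coversᵇ n h S T =
  ⌊ S ⊂? T ⌋ ∧ not (any (λ U → ⌊ S ⊂? U ⌋ ∧ ⌊ U ⊂? T ⌋) (independentSets n h))

M : ℕ → ℕ → ℕ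
M n h = length (filterᵇ (λ { (S , T) → coversᵇ n h S T })
                        (cartesianProduct (independentSets n h) (independentSets n h)))

module Submission where

-- Number the vertices 0,…,n-1 and let I be the family of independent sets.
-- I is closed under taking subsets, so an independent set T covers exactly
-- the sets T ∖ {x} with x ∈ T, and therefore M_n^(h) = Σ_{T ∈ I} |T|.
-- Exchanging the two summations gives M_n^(h) = Σ_{k<n} #{T ∈ I : k ∈ T}.
-- Rotating the cycle is an automorphism, so every summand equals the number
-- of independent sets through vertex 0.  Such a set is {0} ∪ R, where R is
-- an h-separated set of the path h+1,…,n-1-h; scanning R from left to right
-- shows that these sets satisfy G(j+1) = G(j) + G(j-h), the recursion of
-- the h-Fibonacci numbers, whence each summand is F_{n-h}^(h).

open import Defs
open import Data.Nat using (ℕ; zero; suc; _+_; _*_; _∸_; _≤_; _<_; _≤ᵇ_; _≤?_; z≤n; s≤s)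
open import Data.Nat.Properties
open import Data.Nat.Induction using (<-rec)
open import Data.Bool using (Bool; true; false; _∧_; _∨_; not; if_then_else_; T)
open import Data.Bool.Properties using (∧-zeroʳ; ∧-identityʳ)
open import Data.Bool.ListAction using (all; any)
open import Data.Unit using (tt)
open import Data.Vec using (Vec; []; _∷_; _++_)
open import Data.List as List using (List; []; _∷_; filterᵇ; length; allFin; cartesianProduct)
open import Data.List.Relation.Unary.Any using (here; there)
open import Data.List.Membership.Propositional using (_∈_)
open import Data.List.Membership.Propositional.Properties using (∈-allFin; ∈-map⁺; ∈-++⁺ˡ; ∈-++⁺ʳ)
open import Data.Fin using (Fin; toℕ; fromℕ<) renaming (zero to fzero; suc to fsuc)
open import Data.Fin.Properties using (toℕ-fromℕ<)
open import Data.Fin.Subset using (Subset; ∣_∣)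
open import Data.Fin.Subset.Properties using (_∈?_; _⊂?_; _⊆?_)
open import Relation.Nullary using (yes; no)
open import Relation.Nullary.Decidable using (⌊_⌋; ⌊⌋-map′)
open import Relation.Binary.Definitions using (tri<; tri≈; tri>)
open import Data.Product using (Σ; _×_; _,_; proj₁; proj₂)
open import Data.Empty using (⊥-elim)
open import Function using (_∘_)
open import Relation.Binary.PropositionalEquality
open import Algebra.Properties.CommutativeSemigroup +-commutativeSemigroup using (interchange; x∙yz≈y∙xz)

χ : Bool → ℕ
χ true = 1
χ false = 0

when : Bool → ℕ → ℕ
when b x = if b then x else 0

when-χ : ∀ b c → when b (χ c) ≡ χ (b ∧ c)
when-χ true c = refl
when-χ false c = refl

Σ-list : {A : Set} → (A → ℕ) → List A → ℕ
Σ-list f [] = 0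
Σ-list f (x ∷ xs) = f x + Σ-list f xs

Σ-list-++ : {A : Set} (f : A → ℕ) (xs ys : List A) →
  Σ-list f (xs List.++ ys) ≡ Σ-list f xs + Σ-list f ys
Σ-list-++ f [] ys = refl
Σ-list-++ f (x ∷ xs) ys = trans (cong (f x +_) (Σ-list-++ f xs ys)) (sym (+-assoc (f x) _ _))

Σ-list-map : {A B : Set} (f : B → ℕ) (g : A → B) (xs : List A) →
  Σ-list f (List.map g xs) ≡ Σ-list (f ∘ g) xs
Σ-list-map f g [] = refl
Σ-list-map f g (x ∷ xs) = cong (f (g x) +_) (Σ-list-map f g xs)

Σ-list-filter : {A : Set} (f : A → ℕ) (p : A → Bool) (xs : List A) →
  Σ-list f (filterᵇ p xs) ≡ Σ-list (λ x → when (p x) (f x)) xs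
Σ-list-filter f p [] = refl
Σ-list-filter f p (x ∷ xs) with p x
... | true = cong (f x +_) (Σ-list-filter f p xs)
... | false = Σ-list-filter f p xs

length-filter : {A : Set} (p : A → Bool) (xs : List A) →
  length (filterᵇ p xs) ≡ Σ-list (χ ∘ p) xs
length-filter p [] = refl
length-filter p (x ∷ xs) with p x
... | true = cong suc (length-filter p xs)
... | false = length-filter p xs

Σ-list-cartesian : {A B : Set} (g : A × B → ℕ) (xs : List A) (ys : List B) →
  Σ-list g (cartesianProduct xs ys) ≡ Σ-list (λ x → Σ-list (λ y → g (x , y)) ys) xs
Σ-list-cartesian g [] ys = refl
Σ-list-cartesian g (x ∷ xs) ys = trans (Σ-list-++ g (List.map (x ,_) ys) _)
  (cong₂ _+_ (Σ-list-map g (x ,_) ys) (Σ-list-cartesian g xs ys))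

Σ-vec : (n : ℕ) → (Vec Bool n → ℕ) → ℕ
Σ-vec zero g = g []
Σ-vec (suc n) g = Σ-vec n (λ v → g (false ∷ v)) + Σ-vec n (λ v → g (true ∷ v))

Σ-vec-cong : (n : ℕ) {f g : Vec Bool n → ℕ} → (∀ v → f v ≡ g v) → Σ-vec n f ≡ Σ-vec n g
Σ-vec-cong zero e = e []
Σ-vec-cong (suc n) e = cong₂ _+_ (Σ-vec-cong n (e ∘ (false ∷_))) (Σ-vec-cong n (e ∘ (true ∷_)))

Σ-vec-zero : (n : ℕ) → Σ-vec n (λ _ → 0) ≡ 0
Σ-vec-zero zero = refl
Σ-vec-zero (suc n) = cong₂ _+_ (Σ-vec-zero n) (Σ-vec-zero n)

Σ-vec-+ : (n : ℕ) (f g : Vec Bool n → ℕ) → Σ-vec n (λ v → f v + g v) ≡ Σ-vec n f + Σ-vec n g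
Σ-vec-+ zero f g = refl
Σ-vec-+ (suc n) f g =
  trans (cong₂ _+_ (Σ-vec-+ n _ _) (Σ-vec-+ n _ _)) (interchange (Σ-vec n _) _ _ _)

Σ-vec-swap : (n m : ℕ) (g : Vec Bool n → Vec Bool m → ℕ) →
  Σ-vec n (λ u → Σ-vec m (g u)) ≡ Σ-vec m (λ v → Σ-vec n (λ u → g u v))
Σ-vec-swap zero m g = refl
Σ-vec-swap (suc n) m g =
  trans (cong₂ _+_ (Σ-vec-swap n m _) (Σ-vec-swap n m _)) (sym (Σ-vec-+ m _ _))

Σ-vec-++ : (n m : ℕ) (g : Vec Bool (n + m) → ℕ) →
  Σ-vec (n + m) g ≡ Σ-vec n (λ u → Σ-vec m (λ v → g (u ++ v)))
Σ-vec-++ zero m g = refl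
Σ-vec-++ (suc n) m g = cong₂ _+_ (Σ-vec-++ n m _) (Σ-vec-++ n m _)

when-Σ-vec : ∀ b n (g : Vec Bool n → ℕ) → when b (Σ-vec n g) ≡ Σ-vec n (λ v → when b (g v))
when-Σ-vec true n g = refl
when-Σ-vec false n g = sym (Σ-vec-zero n)

Σ-range : ℕ → (ℕ → ℕ) → ℕ
Σ-range zero f = 0
Σ-range (suc n) f = f 0 + Σ-range n (f ∘ suc)

Σ-range-cong : ∀ n {f g : ℕ → ℕ} → (∀ k → f k ≡ g k) → Σ-range n f ≡ Σ-range n g
Σ-range-cong zero e = refl
Σ-range-cong (suc n) e = cong₂ _+_ (e 0) (Σ-range-cong n (e ∘ suc))

Σ-range-zero : ∀ n → Σ-range n (λ _ → 0) ≡ 0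
Σ-range-zero zero = refl
Σ-range-zero (suc n) = Σ-range-zero n

Σ-range-const : ∀ n (f : ℕ → ℕ) c → (∀ k → k < n → f k ≡ c) → Σ-range n f ≡ n * c
Σ-range-const zero f c e = refl
Σ-range-const (suc n) f c e =
  cong₂ _+_ (e 0 (s≤s z≤n)) (Σ-range-const n _ c (λ k k<n → e (suc k) (s≤s k<n)))

when-Σ-range : ∀ b n (f : ℕ → ℕ) → when b (Σ-range n f) ≡ Σ-range n (λ k → when b (f k))
when-Σ-range true n f = refl
when-Σ-range false n f = sym (Σ-range-zero n)

Σ-vec-range-swap : ∀ n m (g : Vec Bool n → ℕ → ℕ) →
  Σ-vec n (λ v → Σ-range m (g v)) ≡ Σ-range m (λ k → Σ-vec n (λ v → g v k))
Σ-vec-range-swap n zero g = Σ-vec-zero n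
Σ-vec-range-swap n (suc m) g =
  trans (Σ-vec-+ n _ _) (cong (Σ-vec n (λ v → g v 0) +_) (Σ-vec-range-swap n m (λ v → g v ∘ suc)))

≡true-iff : ∀ {x y} → (x ≡ true → y ≡ true) → (y ≡ true → x ≡ true) → x ≡ y
≡true-iff {false} {false} f g = refl
≡true-iff {false} {true} f g = g refl
≡true-iff {true} {false} f g = sym (f refl)
≡true-iff {true} {true} f g = refl

≤ᵇ≡true⇒≤ : ∀ m n → (m ≤ᵇ n) ≡ true → m ≤ n
≤ᵇ≡true⇒≤ m n e = ≤ᵇ⇒≤ m n (subst T (sym e) tt)

≤ᵇ≡false⇒> : ∀ m n → (m ≤ᵇ n) ≡ false → n < m
≤ᵇ≡false⇒> m n e = ≰⇒> (λ m≤n → subst T e (≤⇒≤ᵇ m≤n))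

≤⇒≤ᵇ≡true : ∀ {m n} → m ≤ n → (m ≤ᵇ n) ≡ true
≤⇒≤ᵇ≡true {m} {n} m≤n with m ≤ᵇ n | ≤⇒≤ᵇ m≤n
... | true | _ = refl

>⇒≤ᵇ≡false : ∀ {m n} → n < m → (m ≤ᵇ n) ≡ false
>⇒≤ᵇ≡false {m} {n} n<m with m ≤ᵇ n in eq
... | false = refl
... | true = ⊥-elim (<⇒≱ n<m (≤ᵇ≡true⇒≤ m n eq))

all-elim : {A : Set} (p : A → Bool) (xs : List A) → all p xs ≡ true → ∀ {x} → x ∈ xs → p x ≡ true
all-elim p (y ∷ xs) e (here refl) with p y
... | true = refl
all-elim p (y ∷ xs) e (there x∈xs) with p y
... | true = all-elim p xs e x∈xs

all-intro : {A : Set} (p : A → Bool) (xs : List A) → (∀ x → p x ≡ true) → all p xs ≡ true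
all-intro p [] f = refl
all-intro p (y ∷ xs) f rewrite f y = all-intro p xs f

any-false : {A : Set} (p : A → Bool) (xs : List A) → (∀ x → p x ≡ false) → any p xs ≡ false
any-false p [] f = refl
any-false p (x ∷ xs) f rewrite f x = any-false p xs f

any-true : {A : Set} (p : A → Bool) (xs : List A) {x : A} → x ∈ xs → p x ≡ true → any p xs ≡ true
any-true p (y ∷ xs) (here refl) e rewrite e = refl
any-true p (y ∷ xs) (there x∈xs) e with p y
... | true = refl
... | false = any-true p xs x∈xs e

any-cong : {A : Set} {p q : A → Bool} (xs : List A) → (∀ x → p x ≡ q x) → any p xs ≡ any q xs
any-cong [] f = refl
any-cong {p = p} {q} (x ∷ xs) f rewrite f x | any-cong {p = p} {q} xs f = refl

∈-filter : {A : Set} (p : A → Bool) (xs : List A) {x : A} →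
  x ∈ xs → p x ≡ true → x ∈ filterᵇ p xs
∈-filter p (y ∷ xs) (here refl) e rewrite e = here refl
∈-filter p (y ∷ xs) (there x∈xs) e with p y
... | true = there (∈-filter p xs x∈xs e)
... | false = ∈-filter p xs x∈xs e

∈-allSubsets : (n : ℕ) (U : Subset n) → U ∈ allSubsets n
∈-allSubsets zero [] = here refl
∈-allSubsets (suc n) (false ∷ U) = ∈-++⁺ˡ (∈-map⁺ (false ∷_) (∈-allSubsets n U))
∈-allSubsets (suc n) (true ∷ U) =
  ∈-++⁺ʳ (List.map (false ∷_) (allSubsets n)) (∈-map⁺ (true ∷_) (∈-allSubsets n U))

Σ-allSubsets : (n : ℕ) (f : Subset n → ℕ) → Σ-list f (allSubsets n) ≡ Σ-vec n f
Σ-allSubsets zero f = +-identityʳ (f [])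
Σ-allSubsets (suc n) f = trans (Σ-list-++ f (List.map (false ∷_) (allSubsets n)) _)
  (cong₂ _+_ (trans (Σ-list-map f _ (allSubsets n)) (Σ-allSubsets n _))
             (trans (Σ-list-map f _ (allSubsets n)) (Σ-allSubsets n _)))

-- Membership of a natural number (false beyond the end of the vector).
at : {n : ℕ} → Subset n → ℕ → Bool
at [] _ = false
at (x ∷ v) zero = x
at (x ∷ v) (suc i) = at v i

at-bound : {n : ℕ} (S : Subset n) (i : ℕ) → at S i ≡ true → i < n
at-bound (x ∷ S) zero e = s≤s z≤n
at-bound (x ∷ S) (suc i) e = s≤s (at-bound S i e)

at-toℕ : {n : ℕ} (S : Subset n) (i : Fin n) → ⌊ i ∈? S ⌋ ≡ at S (toℕ i)
at-toℕ (true ∷ S) fzero = refl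
at-toℕ (false ∷ S) fzero = refl
at-toℕ (x ∷ S) (fsuc i) = trans (⌊⌋-map′ _ _ (i ∈? S)) (at-toℕ S i)

at-++ˡ : {a b : ℕ} (A : Subset a) (B : Subset b) (i : ℕ) → i < a → at (A ++ B) i ≡ at A i
at-++ˡ (x ∷ A) B zero i<a = refl
at-++ˡ (x ∷ A) B (suc i) (s≤s i<a) = at-++ˡ A B i i<a

at-++ʳ : {a b : ℕ} (A : Subset a) (B : Subset b) (t : ℕ) → at (A ++ B) (a + t) ≡ at B t
at-++ʳ [] B t = refl
at-++ʳ (x ∷ A) B t = at-++ʳ A B t

∣∣-Σ-range : {n : ℕ} (S : Subset n) → ∣ S ∣ ≡ Σ-range n (χ ∘ at S)
∣∣-Σ-range [] = refl
∣∣-Σ-range (true ∷ S) = cong suc (∣∣-Σ-range S)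
∣∣-Σ-range (false ∷ S) = ∣∣-Σ-range S

-- The Boolean lattice, computed position by position: inclusion, strict
-- inclusion, equality, and the covering relation  S ⋖ᵇ T  ("T is S with
-- exactly one element added").

infix 4 _⊆ᵇ_ _⊂ᵇ_ _≐ᵇ_ _⋖ᵇ_

_⊆ᵇ_ : {n : ℕ} → Subset n → Subset n → Bool
[] ⊆ᵇ [] = true
(false ∷ p) ⊆ᵇ (_ ∷ q) = p ⊆ᵇ q
(true ∷ p) ⊆ᵇ (false ∷ q) = false
(true ∷ p) ⊆ᵇ (true ∷ q) = p ⊆ᵇ q

_⊂ᵇ_ : {n : ℕ} → Subset n → Subset n → Bool
[] ⊂ᵇ [] = false
(false ∷ p) ⊂ᵇ (false ∷ q) = p ⊂ᵇ q
(false ∷ p) ⊂ᵇ (true ∷ q) = p ⊆ᵇ q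
(true ∷ p) ⊂ᵇ (false ∷ q) = false
(true ∷ p) ⊂ᵇ (true ∷ q) = p ⊂ᵇ q

_≐ᵇ_ : {n : ℕ} → Subset n → Subset n → Bool
[] ≐ᵇ [] = true
(false ∷ p) ≐ᵇ (false ∷ q) = p ≐ᵇ q
(false ∷ p) ≐ᵇ (true ∷ q) = false
(true ∷ p) ≐ᵇ (false ∷ q) = false
(true ∷ p) ≐ᵇ (true ∷ q) = p ≐ᵇ q

_⋖ᵇ_ : {n : ℕ} → Subset n → Subset n → Bool
[] ⋖ᵇ [] = false
(false ∷ p) ⋖ᵇ (false ∷ q) = p ⋖ᵇ q
(false ∷ p) ⋖ᵇ (true ∷ q) = p ≐ᵇ q
(true ∷ p) ⋖ᵇ (false ∷ q) = false
(true ∷ p) ⋖ᵇ (true ∷ q) = p ⋖ᵇ q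

⊆?≡⊆ᵇ : {n : ℕ} (p q : Subset n) → ⌊ p ⊆? q ⌋ ≡ (p ⊆ᵇ q)
⊆?≡⊆ᵇ [] [] = refl
⊆?≡⊆ᵇ (false ∷ p) (y ∷ q) = trans (⌊⌋-map′ _ _ (p ⊆? q)) (⊆?≡⊆ᵇ p q)
⊆?≡⊆ᵇ (true ∷ p) (false ∷ q) = refl
⊆?≡⊆ᵇ (true ∷ p) (true ∷ q) = trans (⌊⌋-map′ _ _ (p ⊆? q)) (⊆?≡⊆ᵇ p q)

⊂?≡⊂ᵇ : {n : ℕ} (p q : Subset n) → ⌊ p ⊂? q ⌋ ≡ (p ⊂ᵇ q)
⊂?≡⊂ᵇ [] [] = refl
⊂?≡⊂ᵇ (false ∷ p) (false ∷ q) = trans (⌊⌋-map′ _ _ (p ⊂? q)) (⊂?≡⊂ᵇ p q)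
⊂?≡⊂ᵇ (false ∷ p) (true ∷ q) = trans (⌊⌋-map′ _ _ (p ⊆? q)) (⊆?≡⊆ᵇ p q)
⊂?≡⊂ᵇ (true ∷ p) (false ∷ q) = refl
⊂?≡⊂ᵇ (true ∷ p) (true ∷ q) = trans (⌊⌋-map′ _ _ (p ⊂? q)) (⊂?≡⊂ᵇ p q)

⊆ᵇ-refl : {n : ℕ} (p : Subset n) → (p ⊆ᵇ p) ≡ true
⊆ᵇ-refl [] = refl
⊆ᵇ-refl (false ∷ p) = ⊆ᵇ-refl p
⊆ᵇ-refl (true ∷ p) = ⊆ᵇ-refl p

⊂ᵇ⇒⊆ᵇ : {n : ℕ} (p q : Subset n) → (p ⊂ᵇ q) ≡ true → (p ⊆ᵇ q) ≡ true
⊂ᵇ⇒⊆ᵇ [] [] ()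
⊂ᵇ⇒⊆ᵇ (false ∷ p) (false ∷ q) e = ⊂ᵇ⇒⊆ᵇ p q e
⊂ᵇ⇒⊆ᵇ (false ∷ p) (true ∷ q) e = e
⊂ᵇ⇒⊆ᵇ (true ∷ p) (true ∷ q) e = ⊂ᵇ⇒⊆ᵇ p q e

⊆ᵇ-≠⇒⊂ᵇ : {n : ℕ} (p q : Subset n) →
  (p ⊆ᵇ q) ≡ true → (p ≐ᵇ q) ≡ false → (p ⊂ᵇ q) ≡ true
⊆ᵇ-≠⇒⊂ᵇ [] [] _ ()
⊆ᵇ-≠⇒⊂ᵇ (false ∷ p) (false ∷ q) e f = ⊆ᵇ-≠⇒⊂ᵇ p q e f
⊆ᵇ-≠⇒⊂ᵇ (false ∷ p) (true ∷ q) e f = e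
⊆ᵇ-≠⇒⊂ᵇ (true ∷ p) (true ∷ q) e f = ⊆ᵇ-≠⇒⊂ᵇ p q e f

≐ᵇ⇒⊆ᵇ : {n : ℕ} (p q : Subset n) → (p ≐ᵇ q) ≡ true → (p ⊆ᵇ q) ≡ true
≐ᵇ⇒⊆ᵇ [] [] e = refl
≐ᵇ⇒⊆ᵇ (false ∷ p) (false ∷ q) e = ≐ᵇ⇒⊆ᵇ p q e
≐ᵇ⇒⊆ᵇ (true ∷ p) (true ∷ q) e = ≐ᵇ⇒⊆ᵇ p q e

⋖ᵇ⇒⊂ᵇ : {n : ℕ} (p q : Subset n) → (p ⋖ᵇ q) ≡ true → (p ⊂ᵇ q) ≡ true
⋖ᵇ⇒⊂ᵇ [] [] ()
⋖ᵇ⇒⊂ᵇ (false ∷ p) (false ∷ q) e = ⋖ᵇ⇒⊂ᵇ p q e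
⋖ᵇ⇒⊂ᵇ (false ∷ p) (true ∷ q) e = ≐ᵇ⇒⊆ᵇ p q e
⋖ᵇ⇒⊂ᵇ (true ∷ p) (true ∷ q) e = ⋖ᵇ⇒⊂ᵇ p q e

⊆ᵇ-at : {n : ℕ} (p q : Subset n) → (p ⊆ᵇ q) ≡ true → ∀ i → at p i ≡ true → at q i ≡ true
⊆ᵇ-at (false ∷ p) (y ∷ q) e (suc i) a = ⊆ᵇ-at p q e i a
⊆ᵇ-at (true ∷ p) (true ∷ q) e zero a = refl
⊆ᵇ-at (true ∷ p) (true ∷ q) e (suc i) a = ⊆ᵇ-at p q e i a

⊆ᵇ⇒∣∣≤ : {n : ℕ} (p q : Subset n) → (p ⊆ᵇ q) ≡ true → ∣ p ∣ ≤ ∣ q ∣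
⊆ᵇ⇒∣∣≤ [] [] e = z≤n
⊆ᵇ⇒∣∣≤ (false ∷ p) (false ∷ q) e = ⊆ᵇ⇒∣∣≤ p q e
⊆ᵇ⇒∣∣≤ (false ∷ p) (true ∷ q) e = m≤n⇒m≤1+n (⊆ᵇ⇒∣∣≤ p q e)
⊆ᵇ⇒∣∣≤ (true ∷ p) (true ∷ q) e = s≤s (⊆ᵇ⇒∣∣≤ p q e)

⊂ᵇ⇒∣∣< : {n : ℕ} (p q : Subset n) → (p ⊂ᵇ q) ≡ true → ∣ p ∣ < ∣ q ∣
⊂ᵇ⇒∣∣< [] [] ()
⊂ᵇ⇒∣∣< (false ∷ p) (false ∷ q) e = ⊂ᵇ⇒∣∣< p q e
⊂ᵇ⇒∣∣< (false ∷ p) (true ∷ q) e = s≤s (⊆ᵇ⇒∣∣≤ p q e)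
⊂ᵇ⇒∣∣< (true ∷ p) (true ∷ q) e = s≤s (⊂ᵇ⇒∣∣< p q e)

≐ᵇ⇒∣∣≡ : {n : ℕ} (p q : Subset n) → (p ≐ᵇ q) ≡ true → ∣ p ∣ ≡ ∣ q ∣
≐ᵇ⇒∣∣≡ [] [] e = refl
≐ᵇ⇒∣∣≡ (false ∷ p) (false ∷ q) e = ≐ᵇ⇒∣∣≡ p q e
≐ᵇ⇒∣∣≡ (true ∷ p) (true ∷ q) e = cong suc (≐ᵇ⇒∣∣≡ p q e)

⋖ᵇ⇒∣∣≡suc : {n : ℕ} (p q : Subset n) → (p ⋖ᵇ q) ≡ true → ∣ q ∣ ≡ suc ∣ p ∣
⋖ᵇ⇒∣∣≡suc [] [] ()
⋖ᵇ⇒∣∣≡suc (false ∷ p) (false ∷ q) e = ⋖ᵇ⇒∣∣≡suc p q e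
⋖ᵇ⇒∣∣≡suc (false ∷ p) (true ∷ q) e = cong suc (sym (≐ᵇ⇒∣∣≡ p q e))
⋖ᵇ⇒∣∣≡suc (true ∷ p) (true ∷ q) e = cong suc (⋖ᵇ⇒∣∣≡suc p q e)

⋖ᵇ-nothing-between : {n : ℕ} (S T : Subset n) → (S ⋖ᵇ T) ≡ true →
  ∀ U → ((S ⊂ᵇ U) ∧ (U ⊂ᵇ T)) ≡ false
⋖ᵇ-nothing-between S T S⋖T U with S ⊂ᵇ U in S⊂U | U ⊂ᵇ T in U⊂T
... | false | _ = refl
... | true | false = refl
... | true | true = ⊥-elim (<-irrefl refl (begin-strict
  ∣ T ∣     ≡⟨ ⋖ᵇ⇒∣∣≡suc S T S⋖T ⟩
  suc ∣ S ∣ ≤⟨ ⊂ᵇ⇒∣∣< S U S⊂U ⟩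
  ∣ U ∣     <⟨ ⊂ᵇ⇒∣∣< U T U⊂T ⟩
  ∣ T ∣     ∎))
  where open ≤-Reasoning

⊂ᵇ-between : {n : ℕ} (S T : Subset n) → (S ⊂ᵇ T) ≡ true → (S ⋖ᵇ T) ≡ false →
  Σ (Subset n) (λ U → ((S ⊂ᵇ U) ≡ true) × ((U ⊂ᵇ T) ≡ true))
⊂ᵇ-between [] [] () _
⊂ᵇ-between (false ∷ p) (false ∷ q) p⊂q ¬p⋖q with ⊂ᵇ-between p q p⊂q ¬p⋖q
... | U , p⊂U , U⊂q = (false ∷ U) , p⊂U , U⊂q
⊂ᵇ-between (false ∷ p) (true ∷ q) p⊆q p≠q =
  (true ∷ p) , ⊆ᵇ-refl p , ⊆ᵇ-≠⇒⊂ᵇ p q p⊆q p≠q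
⊂ᵇ-between (true ∷ p) (true ∷ q) p⊂q ¬p⋖q with ⊂ᵇ-between p q p⊂q ¬p⋖q
... | U , p⊂U , U⊂q = (true ∷ U) , p⊂U , U⊂q

Σ-vec-≐ᵇ : (n : ℕ) (T : Subset n) → Σ-vec n (λ S → χ (S ≐ᵇ T)) ≡ 1
Σ-vec-≐ᵇ zero [] = refl
Σ-vec-≐ᵇ (suc n) (false ∷ T) = cong₂ _+_ (Σ-vec-≐ᵇ n T) (Σ-vec-zero n)
Σ-vec-≐ᵇ (suc n) (true ∷ T) = cong₂ _+_ (Σ-vec-zero n) (Σ-vec-≐ᵇ n T)

Σ-vec-⋖ᵇ : (n : ℕ) (T : Subset n) → Σ-vec n (λ S → χ (S ⋖ᵇ T)) ≡ ∣ T ∣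
Σ-vec-⋖ᵇ zero [] = refl
Σ-vec-⋖ᵇ (suc n) (false ∷ T) = trans (cong₂ _+_ (Σ-vec-⋖ᵇ n T) (Σ-vec-zero n)) (+-identityʳ _)
Σ-vec-⋖ᵇ (suc n) (true ∷ T) = cong₂ _+_ (Σ-vec-≐ᵇ n T) (Σ-vec-⋖ᵇ n T)

-- Two positions i < j are
-- non-adjacent iff they are more than h apart in both directions around
-- the cycle; a set is independent iff all its pairs are so separated.

Separated : (n h i j : ℕ) → Set
Separated n h i j = (i + h < j) × (j + h < n + i)

Independent : (n h : ℕ) → (ℕ → Bool) → Set
Independent n h s = ∀ i j → i < j → s i ≡ true → s j ≡ true → Separated n h i j

edgeLengthᵇ : (n h d : ℕ) → Bool
edgeLengthᵇ n h d = not (d ≤ᵇ 0) ∧ ((d ≤ᵇ h) ∨ ((n ∸ h) ≤ᵇ d))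

adjacentᵇ : (n h i j : ℕ) → Bool
adjacentᵇ n h i j = edgeLengthᵇ n h (absDiff i j)

data Gap (i : ℕ) : ℕ → Set where
  gap : ∀ d → Gap i (i + suc d)

gap-view : ∀ {i j} → i < j → Gap i j
gap-view {zero} {suc d} _ = gap d
gap-view {suc i} {suc j} (s≤s i<j) with gap-view i<j
... | gap d = gap d

absDiff-gap : ∀ i d → absDiff i (i + d) ≡ d
absDiff-gap i d rewrite m≤n⇒m∸n≡0 (m≤m+n i d) = m+n∸m≡n i d

absDiff-comm : ∀ i j → absDiff i j ≡ absDiff j i
absDiff-comm i j = +-comm (i ∸ j) (j ∸ i)

non-edge-length : ∀ n h d → edgeLengthᵇ n h (suc d) ≡ false → (h < suc d) × (suc d + h < n)
non-edge-length n h d e with suc d ≤ᵇ h in e₁ | (n ∸ h) ≤ᵇ suc d in e₂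
... | false | false = ≤ᵇ≡false⇒> (suc d) h e₁ , d+h<n
  where
  d<n∸h : suc d < n ∸ h
  d<n∸h = ≤ᵇ≡false⇒> (n ∸ h) (suc d) e₂
  h<n : h < n
  h<n = m∸n≢0⇒n<m (λ n∸h≡0 → n≮0 (subst (suc d <_) n∸h≡0 d<n∸h))
  d+h<n : suc d + h < n
  d+h<n = m≤o∸n⇒m+n≤o (suc (suc d)) (<⇒≤ h<n) d<n∸h

non-edge-length⁻ : ∀ n h d → h < suc d → suc d + h < n → edgeLengthᵇ n h (suc d) ≡ false
non-edge-length⁻ n h d h<d d+h<n
  rewrite >⇒≤ᵇ≡false {suc d} {h} h<d
        | >⇒≤ᵇ≡false {n ∸ h} {suc d} (m+n≤o⇒m≤o∸n (suc (suc d)) d+h<n) = refl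

separated-gap : ∀ n h i d → (h < d) × (d + h < n) → Separated n h i (i + d)
separated-gap n h i d (h<d , d+h<n) =
  +-monoʳ-< i h<d ,
  subst₂ _<_ (sym (+-assoc i d h)) (+-comm i n) (+-monoʳ-< i d+h<n)

separated-gap⁻ : ∀ n h i d → Separated n h i (i + d) → (h < d) × (d + h < n)
separated-gap⁻ n h i d (i+h<i+d , i+d+h<n+i) =
  +-cancelˡ-< i h d i+h<i+d ,
  +-cancelˡ-< i (d + h) n (subst₂ _<_ (+-assoc i d h) (+-comm n i) i+d+h<n+i)

nonadjacent⇒separated : ∀ {n h i j} → i < j → adjacentᵇ n h i j ≡ false → Separated n h i j
nonadjacent⇒separated {n} {h} {i} i<j e with gap-view i<j
... | gap d = separated-gap n h i (suc d)
                (non-edge-length n h d (subst (λ x → edgeLengthᵇ n h x ≡ false) (absDiff-gap i (suc d)) e))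

separated⇒nonadjacent : ∀ {n h i j} → i < j → Separated n h i j → adjacentᵇ n h i j ≡ false
separated⇒nonadjacent {n} {h} {i} i<j sep with gap-view i<j
... | gap d with separated-gap⁻ n h i (suc d) sep
... | h<d , d+h<n rewrite absDiff-gap i (suc d) = non-edge-length⁻ n h d h<d d+h<n

independentᵇ⇒Independent : ∀ n h (S : Subset n) →
  isIndependentᵇ n h S ≡ true → Independent n h (at S)
independentᵇ⇒Independent n h S indep i j i<j i∈S j∈S =
  nonadjacent⇒separated i<j
    (subst₂ (λ x y → adjacentᵇ n h x y ≡ false) (toℕ-fromℕ< i<n) (toℕ-fromℕ< j<n) not-adjacent)
  where
  i<n = at-bound S i i∈S
  j<n = at-bound S j j∈S
  member : ∀ {k} (k<n : k < n) → at S k ≡ true → ⌊ fromℕ< k<n ∈? S ⌋ ≡ true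
  member {k} k<n k∈S = trans (at-toℕ S (fromℕ< k<n)) (trans (cong (at S) (toℕ-fromℕ< k<n)) k∈S)
  pair-ok : not (⌊ fromℕ< i<n ∈? S ⌋ ∧ ⌊ fromℕ< j<n ∈? S ⌋
                   ∧ adjᵇ n h (fromℕ< i<n) (fromℕ< j<n)) ≡ true
  pair-ok = all-elim _ (allFin n) (all-elim _ (allFin n) indep (∈-allFin (fromℕ< i<n)))
                     (∈-allFin (fromℕ< j<n))
  not-adjacent : adjacentᵇ n h (toℕ (fromℕ< i<n)) (toℕ (fromℕ< j<n)) ≡ false
  not-adjacent with adjᵇ n h (fromℕ< i<n) (fromℕ< j<n) | pair-ok
  ... | false | _ = refl
  ... | true | ok rewrite member i<n i∈S | member j<n j∈S with ok
  ... | ()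

Independent⇒nonadjacent : ∀ n h (s : ℕ → Bool) → Independent n h s →
  ∀ i j → s i ≡ true → s j ≡ true → adjacentᵇ n h i j ≡ false
Independent⇒nonadjacent n h s indep i j i∈s j∈s with <-cmp i j
... | tri< i<j _ _ = separated⇒nonadjacent i<j (indep i j i<j i∈s j∈s)
... | tri> _ _ j<i = trans (cong (edgeLengthᵇ n h) (absDiff-comm i j))
                           (separated⇒nonadjacent j<i (indep j i j<i j∈s i∈s))
... | tri≈ _ refl _ rewrite n∸n≡0 i = refl

Independent⇒independentᵇ : ∀ n h (S : Subset n) →
  Independent n h (at S) → isIndependentᵇ n h S ≡ true
Independent⇒independentᵇ n h S indep =
  all-intro _ (allFin n) λ i → all-intro _ (allFin n) λ j → pair-ok i j
  where
  pair-ok : ∀ i j → not (⌊ i ∈? S ⌋ ∧ ⌊ j ∈? S ⌋ ∧ adjᵇ n h i j) ≡ true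
  pair-ok i j rewrite at-toℕ S i | at-toℕ S j with at S (toℕ i) in i∈S | at S (toℕ j) in j∈S
  ... | false | _ = refl
  ... | true | false = refl
  ... | true | true rewrite Independent⇒nonadjacent n h (at S) indep (toℕ i) (toℕ j) i∈S j∈S = refl

independent-⊆ᵇ : ∀ n h (S T : Subset n) →
  (S ⊆ᵇ T) ≡ true → isIndependentᵇ n h T ≡ true → isIndependentᵇ n h S ≡ true
independent-⊆ᵇ n h S T S⊆T T-indep = Independent⇒independentᵇ n h S λ i j i<j i∈S j∈S →
  independentᵇ⇒Independent n h T T-indep i j i<j (⊆ᵇ-at S T S⊆T i i∈S) (⊆ᵇ-at S T S⊆T j j∈S)

covers-unfold : ∀ n h (S T : Subset n) → coversᵇ n h S T ≡
  (S ⊂ᵇ T) ∧ not (any (λ U → (S ⊂ᵇ U) ∧ (U ⊂ᵇ T)) (independentSets n h))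
covers-unfold n h S T rewrite ⊂?≡⊂ᵇ S T
  | any-cong {p = λ U → ⌊ S ⊂? U ⌋ ∧ ⌊ U ⊂? T ⌋} {q = λ U → (S ⊂ᵇ U) ∧ (U ⊂ᵇ T)}
      (independentSets n h)
      (λ U → cong₂ _∧_ (⊂?≡⊂ᵇ S U) (⊂?≡⊂ᵇ U T)) = refl

-- For independent T:  S is independent and covered by T  iff  S ⋖ᵇ T.  Any
-- strict subset S ⊂ T that is not S ⋖ᵇ T has an intermediate set U, and U is
-- independent because it is a subset of T.
covered-by-independent : ∀ n h (T : Subset n) → isIndependentᵇ n h T ≡ true → ∀ S →
  (isIndependentᵇ n h S ∧ coversᵇ n h S T) ≡ (S ⋖ᵇ T)
covered-by-independent n h T T-indep S rewrite covers-unfold n h S T with S ⋖ᵇ T in S⋖T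
... | true rewrite independent-⊆ᵇ n h S T (⊂ᵇ⇒⊆ᵇ S T (⋖ᵇ⇒⊂ᵇ S T S⋖T)) T-indep
                 | ⋖ᵇ⇒⊂ᵇ S T S⋖T
                 | any-false _ (independentSets n h) (⋖ᵇ-nothing-between S T S⋖T) = refl
... | false with isIndependentᵇ n h S | S ⊂ᵇ T in S⊂T
... | false | _ = refl
... | true | false = refl
... | true | true with ⊂ᵇ-between S T S⊂T S⋖T
... | U , S⊂U , U⊂T rewrite any-true (λ U → (S ⊂ᵇ U) ∧ (U ⊂ᵇ T)) (independentSets n h)
        (∈-filter _ (allSubsets n) (∈-allSubsets n U)
          (independent-⊆ᵇ n h U T (⊂ᵇ⇒⊆ᵇ U T U⊂T) T-indep))
        (cong₂ _∧_ S⊂U U⊂T) = refl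

Σ-independentSets : ∀ n h (f : Subset n → ℕ) →
  Σ-list f (independentSets n h) ≡ Σ-vec n (λ S → when (isIndependentᵇ n h S) (f S))
Σ-independentSets n h f = trans (Σ-list-filter f (isIndependentᵇ n h) (allSubsets n)) (Σ-allSubsets n _)

-- Each independent T is the top of exactly ∣ T ∣ edges of the Hasse diagram.
hasse-edges : ∀ n h → M n h ≡ Σ-vec n (λ T → when (isIndependentᵇ n h T) ∣ T ∣)
hasse-edges n h = begin
  M n h
    ≡⟨ length-filter _ (cartesianProduct I I) ⟩
  Σ-list (χ ∘ edge) (cartesianProduct I I)
    ≡⟨ Σ-list-cartesian (χ ∘ edge) I I ⟩
  Σ-list (λ S → Σ-list (λ T → χ (coversᵇ n h S T)) I) I
    ≡⟨ Σ-independentSets n h _ ⟩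
  Σ-vec n (λ S → when (ind S) (Σ-list (λ T → χ (coversᵇ n h S T)) I))
    ≡⟨ Σ-vec-cong n (λ S → trans (cong (when (ind S)) (Σ-independentSets n h _))
                                 (when-Σ-vec (ind S) n _)) ⟩
  Σ-vec n (λ S → Σ-vec n (λ T → when (ind S) (when (ind T) (χ (coversᵇ n h S T)))))
    ≡⟨ Σ-vec-cong n (λ S → Σ-vec-cong n (λ T → when-swap (ind S) (ind T) _)) ⟩
  Σ-vec n (λ S → Σ-vec n (λ T → when (ind T) (when (ind S) (χ (coversᵇ n h S T)))))
    ≡⟨ Σ-vec-swap n n _ ⟩
  Σ-vec n (λ T → Σ-vec n (λ S → when (ind T) (when (ind S) (χ (coversᵇ n h S T)))))
    ≡⟨ Σ-vec-cong n (λ T → sym (when-Σ-vec (ind T) n _)) ⟩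
  Σ-vec n (λ T → when (ind T) (Σ-vec n (λ S → when (ind S) (χ (coversᵇ n h S T)))))
    ≡⟨ Σ-vec-cong n edges-below ⟩
  Σ-vec n (λ T → when (ind T) ∣ T ∣) ∎
  where
  open ≡-Reasoning
  I = independentSets n h
  ind = isIndependentᵇ n h
  edge : Subset n × Subset n → Bool
  edge (S , T) = coversᵇ n h S T
  when-swap : ∀ a b x → when a (when b x) ≡ when b (when a x)
  when-swap true b x = refl
  when-swap false true x = refl
  when-swap false false x = refl
  edges-below : ∀ T →
    when (ind T) (Σ-vec n (λ S → when (ind S) (χ (coversᵇ n h S T)))) ≡ when (ind T) ∣ T ∣
  edges-below T with ind T in T-indep
  ... | false = refl
  ... | true = begin
    Σ-vec n (λ S → when (ind S) (χ (coversᵇ n h S T))) ≡⟨ Σ-vec-cong n (λ S → when-χ (ind S) _) ⟩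
    Σ-vec n (λ S → χ (ind S ∧ coversᵇ n h S T))
      ≡⟨ Σ-vec-cong n (cong χ ∘ covered-by-independent n h T T-indep) ⟩
    Σ-vec n (λ S → χ (S ⋖ᵇ T))                          ≡⟨ Σ-vec-⋖ᵇ n T ⟩
    ∣ T ∣ ∎

-- Rotation invariance.  Separation is preserved by translating both
-- positions and by moving the smaller one once around the cycle; hence
-- rotating  A ++ B  to  B ++ A  preserves independence.

separated-shift : ∀ n h c {i j} → Separated n h i j → Separated n h (c + i) (c + j)
separated-shift n h c {i} {j} (i+h<j , j+h<n+i) =
  subst (_< c + j) (sym (+-assoc c i h)) (+-monoʳ-< c i+h<j) ,
  subst₂ _<_ (sym (+-assoc c j h)) (x∙yz≈y∙xz c n i) (+-monoʳ-< c j+h<n+i)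

separated-unshift : ∀ n h c {i j} → Separated n h (c + i) (c + j) → Separated n h i j
separated-unshift n h c {i} {j} (ci+h<cj , cj+h<n+ci) =
  +-cancelˡ-< c (i + h) j (subst (_< c + j) (+-assoc c i h) ci+h<cj) ,
  +-cancelˡ-< c (j + h) (n + i) (subst₂ _<_ (+-assoc c j h) (x∙yz≈y∙xz n c i) cj+h<n+ci)

separated-wrap : ∀ n h {i j} → Separated n h i j → Separated n h j (n + i)
separated-wrap n h {i} {j} (i+h<j , j+h<n+i) =
  j+h<n+i , subst (_< n + j) (sym (+-assoc n i h)) (+-monoʳ-< n i+h<j)

separated-+-comm : ∀ a b h {i j} → Separated (a + b) h i j → Separated (b + a) h i j
separated-+-comm a b h {i} {j} = subst (λ n → Separated n h i j) (+-comm a b)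

data Side (b : ℕ) : ℕ → Set where
  front : ∀ {p} → p < b → Side b p
  back : ∀ q → Side b (b + q)

side : ∀ b p → Side b p
side zero p = back p
side (suc b) zero = front (s≤s z≤n)
side (suc b) (suc p) with side b p
... | front p<b = front (s≤s p<b)
... | back q = back q

front-member : ∀ {a b} (A : Subset a) (B : Subset b) {p} → p < b →
  at (B ++ A) p ≡ true → at (A ++ B) (a + p) ≡ true
front-member A B {p} p<b p∈ = trans (at-++ʳ A B p) (trans (sym (at-++ˡ B A p p<b)) p∈)

back-member : ∀ {a b} (A : Subset a) (B : Subset b) q →
  at (B ++ A) (b + q) ≡ true → (q < a) × (at (A ++ B) q ≡ true)
back-member A B q q∈ = q<a , trans (at-++ˡ A B q q<a) q∈A
  where
  q∈A = trans (sym (at-++ʳ B A q)) q∈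
  q<a = at-bound A q q∈A

rotate-Independent : ∀ h {a b} (A : Subset a) (B : Subset b) →
  Independent (a + b) h (at (A ++ B)) → Independent (b + a) h (at (B ++ A))
rotate-Independent h {a} {b} A B indep i j i<j i∈ j∈ with side b i | side b j
... | front i<b | front j<b =
  separated-+-comm a b h (separated-unshift (a + b) h a
    (indep (a + i) (a + j) (+-monoʳ-< a i<j) (front-member A B i<b i∈) (front-member A B j<b j∈)))
... | front i<b | back q =
  separated-+-comm a b h (separated-unshift (a + b) h a
    (subst (Separated (a + b) h (a + i)) (+-assoc a b q)
      (separated-wrap (a + b) h
        (indep q (a + i) (≤-trans q<a (m≤m+n a i)) q∈ (front-member A B i<b i∈)))))
  where
  q<a = proj₁ (back-member A B q j∈)
  q∈ = proj₂ (back-member A B q j∈)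
... | back q | front j<b = ⊥-elim (<⇒≱ (<-trans i<j j<b) (m≤m+n b q))
... | back q | back q′ =
  separated-+-comm a b h (separated-shift (a + b) h b
    (indep q q′ (+-cancelˡ-< b q q′ i<j)
      (proj₂ (back-member A B q i∈)) (proj₂ (back-member A B q′ j∈))))

rotate-independent : ∀ h {a b} (A : Subset a) (B : Subset b) →
  isIndependentᵇ (a + b) h (A ++ B) ≡ isIndependentᵇ (b + a) h (B ++ A)
rotate-independent h {a} {b} A B = ≡true-iff
  (λ e → Independent⇒independentᵇ (b + a) h (B ++ A)
           (rotate-Independent h A B (independentᵇ⇒Independent (a + b) h (A ++ B) e)))
  (λ e → Independent⇒independentᵇ (a + b) h (A ++ B)
           (rotate-Independent h B A (independentᵇ⇒Independent (b + a) h (B ++ A) e)))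

-- Independent sets through vertex 0.  Such a set is  true ∷ R, and R must be
-- an h-spread subset of the path 0,…,m-1 that avoids the first h and the last
-- h positions (those are the neighbours of vertex 0).  The automaton Pathᵇ
-- recognises these R when scanning from left to right: c counts the
-- positions that must still stay empty, and a member needs h positions after it.

Pathᵇ : (h c : ℕ) {k : ℕ} → Subset k → Bool
Pathᵇ h c [] = true
Pathᵇ h c (false ∷ R) = Pathᵇ h (c ∸ 1) R
Pathᵇ h zero {suc k} (true ∷ R) = (h ≤ᵇ k) ∧ Pathᵇ h h R
Pathᵇ h (suc c) (true ∷ R) = false

Spread : ℕ → (ℕ → Bool) → Set
Spread h r = ∀ i j → i < j → r i ≡ true → r j ≡ true → i + h < j

PathSet : (h c k : ℕ) → (ℕ → Bool) → Set
PathSet h c k r = (∀ j → r j ≡ true → (c ≤ j) × (j + h < k)) × Spread h r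

Spread-tail : ∀ h x {k} (R : Subset k) → Spread h (at (x ∷ R)) → Spread h (at R)
Spread-tail h x R spread i j i<j i∈ j∈ = ≤-pred (spread (suc i) (suc j) (s≤s i<j) i∈ j∈)

Spread-false∷ : ∀ h {k} (R : Subset k) → Spread h (at R) → Spread h (at (false ∷ R))
Spread-false∷ h R spread (suc i) (suc j) (s≤s i<j) i∈ j∈ = s≤s (spread i j i<j i∈ j∈)

pred-≤-suc : ∀ c j → c ∸ 1 ≤ j → c ≤ suc j
pred-≤-suc zero j _ = z≤n
pred-≤-suc (suc c) j c≤j = s≤s c≤j

suc-≤-pred : ∀ c j → c ≤ suc j → c ∸ 1 ≤ j
suc-≤-pred zero j _ = z≤n
suc-≤-pred (suc c) j (s≤s c≤j) = c≤j

Pathᵇ⇒PathSet : ∀ h c {k} (R : Subset k) → Pathᵇ h c R ≡ true → PathSet h c k (at R)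
Pathᵇ⇒PathSet h c [] e = (λ j ()) , (λ i j i<j ())
Pathᵇ⇒PathSet h c (false ∷ R) e with Pathᵇ⇒PathSet h (c ∸ 1) R e
... | bounded , spread = bounded′ , Spread-false∷ h R spread
  where
  bounded′ : ∀ j → at (false ∷ R) j ≡ true → (c ≤ j) × (j + h < suc _)
  bounded′ (suc j) j∈ = pred-≤-suc c j (proj₁ (bounded j j∈)) , s≤s (proj₂ (bounded j j∈))
Pathᵇ⇒PathSet h zero {suc k} (true ∷ R) e with h ≤ᵇ k in h≤k
... | true with Pathᵇ⇒PathSet h h R e
... | bounded , spread = bounded′ , spread′
  where
  bounded′ : ∀ j → at (true ∷ R) j ≡ true → (0 ≤ j) × (j + h < suc k)
  bounded′ zero _ = z≤n , s≤s (≤ᵇ≡true⇒≤ h k h≤k)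
  bounded′ (suc j) j∈ = z≤n , s≤s (proj₂ (bounded j j∈))
  spread′ : Spread h (at (true ∷ R))
  spread′ zero (suc j) _ _ j∈ = s≤s (proj₁ (bounded j j∈))
  spread′ (suc i) (suc j) (s≤s i<j) i∈ j∈ = s≤s (spread i j i<j i∈ j∈)

PathSet⇒Pathᵇ : ∀ h c {k} (R : Subset k) → PathSet h c k (at R) → Pathᵇ h c R ≡ true
PathSet⇒Pathᵇ h c [] _ = refl
PathSet⇒Pathᵇ h c (false ∷ R) (bounded , spread) =
  PathSet⇒Pathᵇ h (c ∸ 1) R (bounded′ , Spread-tail h false R spread)
  where
  bounded′ : ∀ j → at R j ≡ true → (c ∸ 1 ≤ j) × (j + h < _)
  bounded′ j j∈ = suc-≤-pred c j (proj₁ (bounded (suc j) j∈)) , ≤-pred (proj₂ (bounded (suc j) j∈))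
PathSet⇒Pathᵇ h zero {suc k} (true ∷ R) (bounded , spread)
  rewrite ≤⇒≤ᵇ≡true (≤-pred (proj₂ (bounded zero refl))) =
  PathSet⇒Pathᵇ h h R (bounded′ , Spread-tail h true R spread)
  where
  bounded′ : ∀ j → at R j ≡ true → (h ≤ j) × (j + h < k)
  bounded′ j j∈ =
    ≤-pred (spread zero (suc j) (s≤s z≤n) refl j∈) , ≤-pred (proj₂ (bounded (suc j) j∈))
PathSet⇒Pathᵇ h (suc c) (true ∷ R) (bounded , _) with proj₁ (bounded zero refl)
... | ()

Independent⇒PathSet : ∀ h {m} (R : Subset m) →
  Independent (suc m) h (at (true ∷ R)) → PathSet h h m (at R)
Independent⇒PathSet h {m} R indep =
  bounded , Spread-tail h true R (λ i j i<j i∈ j∈ → proj₁ (indep i j i<j i∈ j∈))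
  where
  bounded : ∀ j → at R j ≡ true → (h ≤ j) × (j + h < m)
  bounded j j∈ with indep zero (suc j) (s≤s z≤n) refl j∈
  ... | h<j , j+h<m = ≤-pred h<j , ≤-pred (subst (suc (j + h) <_) (cong suc (+-identityʳ m)) j+h<m)

PathSet⇒Independent : ∀ h {m} (R : Subset m) →
  PathSet h h m (at R) → Independent (suc m) h (at (true ∷ R))
PathSet⇒Independent h {m} R (bounded , spread) zero (suc j) _ _ j∈ =
  s≤s (proj₁ (bounded j j∈)) ,
  subst (suc (j + h) <_) (cong suc (sym (+-identityʳ m))) (s≤s (proj₂ (bounded j j∈)))
PathSet⇒Independent h {m} R (bounded , spread) (suc i) (suc j) (s≤s i<j) i∈ j∈ =
  s≤s (spread i j i<j i∈ j∈) , s≤s (≤-trans (proj₂ (bounded j j∈)) (m≤m+n m (suc i)))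

independent-through-0 : ∀ h {m} (R : Subset m) → isIndependentᵇ (suc m) h (true ∷ R) ≡ Pathᵇ h h R
independent-through-0 h {m} R = ≡true-iff
  (λ e → PathSet⇒Pathᵇ h h R
           (Independent⇒PathSet h R (independentᵇ⇒Independent (suc m) h (true ∷ R) e)))
  (λ e → Independent⇒independentᵇ (suc m) h (true ∷ R)
           (PathSet⇒Independent h R (Pathᵇ⇒PathSet h h R e)))

nth-fibs : ∀ h m i → i ≤ m → nth i (fibs h m) ≡ F h (m ∸ i)
nth-fibs h m zero _ = refl
nth-fibs h (suc m) (suc i) (s≤s i≤m) = nth-fibs h m i i≤m

F-initial : ∀ h t → t ≤ h → F h (suc t) ≡ 1
F-initial h t t≤h rewrite ≤⇒≤ᵇ≡true (s≤s t≤h) = refl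

F-step : ∀ h t → h < t → F h (suc t) ≡ F h t + F h (t ∸ h)
F-step h t h<t rewrite >⇒≤ᵇ≡false {suc t} {suc h} (s≤s h<t) =
  cong (F h t +_) (nth-fibs h t h (<⇒≤ h<t))

-- With no pending gap, a word of
-- length 1+j starts either with a non-member or with a member followed by
-- a gap of h, which gives the h-Fibonacci recursion.

paths : ℕ → ℕ → ℕ
paths h j = Σ-vec j (χ ∘ Pathᵇ h 0)

-- A pending gap of c consumes the first c positions.
paths-after-gap : ∀ h c j → Σ-vec (c + j) (χ ∘ Pathᵇ h c) ≡ paths h j
paths-after-gap h zero j = refl
paths-after-gap h (suc c) j = trans (cong₂ _+_ (paths-after-gap h c j) (Σ-vec-zero (c + j))) (+-identityʳ _)

paths-after-gap′ : ∀ h {j} d → h + d ≡ j → Σ-vec j (χ ∘ Pathᵇ h h) ≡ paths h d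
paths-after-gap′ h d refl = paths-after-gap h h d

paths-suc : ∀ h j → paths h (suc j) ≡ paths h j + when (h ≤ᵇ j) (Σ-vec j (χ ∘ Pathᵇ h h))
paths-suc h j with h ≤ᵇ j
... | true = refl
... | false = cong (paths h j +_) (Σ-vec-zero j)

paths≡F : ∀ h j → paths h j ≡ F h (suc j)
paths≡F h = <-rec _ step
  where
  open ≡-Reasoning
  gapped : ℕ → ℕ
  gapped j = Σ-vec j (χ ∘ Pathᵇ h h)
  step : ∀ j → (∀ {i} → i < j → paths h i ≡ F h (suc i)) → paths h j ≡ F h (suc j)
  step zero _ = refl
  step (suc j) ih with h ≤? j
  ... | yes h≤j = begin
    paths h (suc j)                       ≡⟨ paths-suc h j ⟩
    paths h j + when (h ≤ᵇ j) (gapped j)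
      ≡⟨ cong (λ b → paths h j + when b (gapped j)) (≤⇒≤ᵇ≡true h≤j) ⟩
    paths h j + gapped j
      ≡⟨ cong (paths h j +_) (paths-after-gap′ h (j ∸ h) (m+[n∸m]≡n h≤j)) ⟩
    paths h j + paths h (j ∸ h)           ≡⟨ cong₂ _+_ (ih ≤-refl) (ih (s≤s (m∸n≤m j h))) ⟩
    F h (suc j) + F h (suc (j ∸ h))       ≡⟨ cong (λ x → F h (suc j) + F h x) (sym (+-∸-assoc 1 h≤j)) ⟩
    F h (suc j) + F h (suc j ∸ h)         ≡⟨ sym (F-step h (suc j) (s≤s h≤j)) ⟩
    F h (suc (suc j))                     ∎
  ... | no h≰j = begin
    paths h (suc j)                       ≡⟨ paths-suc h j ⟩
    paths h j + when (h ≤ᵇ j) (gapped j)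
      ≡⟨ cong (λ b → paths h j + when b (gapped j)) (>⇒≤ᵇ≡false j<h) ⟩
    paths h j + 0                         ≡⟨ +-identityʳ _ ⟩
    paths h j                             ≡⟨ ih ≤-refl ⟩
    F h (suc j)                           ≡⟨ F-initial h j (<⇒≤ j<h) ⟩
    1                                     ≡⟨ sym (F-initial h (suc j) j<h) ⟩
    F h (suc (suc j))                     ∎
    where j<h = ≰⇒> h≰j

through : (n h k : ℕ) → ℕ
through n h k = Σ-vec n (λ T → χ (isIndependentᵇ n h T ∧ at T k))

through-0 : ∀ h m → h ≤ m → through (suc m) h 0 ≡ F h (suc m ∸ h)
through-0 h m h≤m = begin
  Σ-vec m (λ R → χ (isIndependentᵇ (suc m) h (false ∷ R) ∧ false))
    + Σ-vec m (λ R → χ (isIndependentᵇ (suc m) h (true ∷ R) ∧ true))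
    ≡⟨ cong₂ _+_ (trans (Σ-vec-cong m (λ R → cong χ (∧-zeroʳ _))) (Σ-vec-zero m))
                 (Σ-vec-cong m (λ R → cong χ (trans (∧-identityʳ _) (independent-through-0 h R)))) ⟩
  Σ-vec m (χ ∘ Pathᵇ h h)   ≡⟨ paths-after-gap′ h (m ∸ h) (m+[n∸m]≡n h≤m) ⟩
  paths h (m ∸ h)           ≡⟨ paths≡F h (m ∸ h) ⟩
  F h (suc (m ∸ h))         ≡⟨ cong (F h) (sym (+-∸-assoc 1 h≤m)) ⟩
  F h (suc m ∸ h)           ∎
  where open ≡-Reasoning

at-++-start : ∀ {a b} (A : Subset a) (B : Subset b) → at (A ++ B) a ≡ at B 0
at-++-start [] B = refl
at-++-start (x ∷ A) B = at-++-start A B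

-- Rotating the cycle so that vertex k becomes vertex 0: write T = A ++ B
-- with |A| = k and count the rotated sets  B ++ A  instead.
through-rotate : ∀ h k b → through (k + suc b) h k ≡ through (suc b + k) h 0
through-rotate h k b = begin
  Σ-vec (k + suc b) at-k                               ≡⟨ Σ-vec-++ k (suc b) at-k ⟩
  Σ-vec k (λ A → Σ-vec (suc b) (λ B → at-k (A ++ B)))
    ≡⟨ Σ-vec-cong k (λ A → Σ-vec-cong (suc b) (λ B →
         cong χ (cong₂ _∧_ (rotate-independent h A B) (at-++-start A B)))) ⟩
  Σ-vec k (λ A → Σ-vec (suc b) (λ B → at-0 (B ++ A)))
    ≡⟨ Σ-vec-swap k (suc b) (λ A B → at-0 (B ++ A)) ⟩
  Σ-vec (suc b) (λ B → Σ-vec k (λ A → at-0 (B ++ A)))  ≡⟨ sym (Σ-vec-++ (suc b) k at-0) ⟩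
  Σ-vec (suc b + k) at-0                               ∎
  where
  open ≡-Reasoning
  at-k : Subset (k + suc b) → ℕ
  at-k T = χ (isIndependentᵇ (k + suc b) h T ∧ at T k)
  at-0 : Subset (suc b + k) → ℕ
  at-0 T = χ (isIndependentᵇ (suc b + k) h T ∧ at T 0)

through-vertex : ∀ n h → h < n → ∀ k → k < n → through n h k ≡ F h (n ∸ h)
through-vertex n h h<n k k<n with gap-view k<n
... | gap b = begin
  through (k + suc b) h k   ≡⟨ through-rotate h k b ⟩
  through (suc b + k) h 0   ≡⟨ through-0 h (b + k) h≤b+k ⟩
  F h (suc b + k ∸ h)       ≡⟨ cong (λ x → F h (x ∸ h)) (+-comm (suc b) k) ⟩
  F h (k + suc b ∸ h)       ∎
  where
  open ≡-Reasoning
  h≤b+k : h ≤ b + k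
  h≤b+k = ≤-pred (subst (h <_) (+-comm k (suc b)) h<n)

-- Double counting: the edges below T are indexed by the vertices of T.
hasse-edges-by-vertex : ∀ n h → M n h ≡ Σ-range n (through n h)
hasse-edges-by-vertex n h = begin
  M n h                                                 ≡⟨ hasse-edges n h ⟩
  Σ-vec n (λ T → when (ind T) ∣ T ∣)                     ≡⟨ Σ-vec-cong n by-vertex ⟩
  Σ-vec n (λ T → Σ-range n (λ k → χ (ind T ∧ at T k)))   ≡⟨ Σ-vec-range-swap n n _ ⟩
  Σ-range n (through n h)                               ∎
  where
  open ≡-Reasoning
  ind = isIndependentᵇ n h
  by-vertex : ∀ T → when (ind T) ∣ T ∣ ≡ Σ-range n (λ k → χ (ind T ∧ at T k))
  by-vertex T = trans (cong (when (ind T)) (∣∣-Σ-range T))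
                  (trans (when-Σ-range (ind T) n _) (Σ-range-cong n (λ k → when-χ (ind T) (at T k))))

proposition5p1 : (n h : ℕ) → h < n → M n h ≡ n * F h (n ∸ h)
proposition5p1 n h h<n = begin
  M n h                     ≡⟨ hasse-edges-by-vertex n h ⟩
  Σ-range n (through n h)   ≡⟨ Σ-range-const n (through n h) _ (through-vertex n h h<n) ⟩
  n * F h (n ∸ h)           ∎
  where open ≡-Reasoning
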